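{- Let $T$ be a tree with vertex set $\{1,\dots,n\}$ and Gram matrix $K=(L+J)^{ -1}$. Let $d_T$ be the path-length distance and $r_i=\sum_{j=1}^nd_T(i,j)$. Then: (i) $K_{i,i}=\frac1n\Big(r_i-\frac1n\sum_{1\le j<m\le n}d_T(j,m)+\frac1n\Big)$ for every vertex $i$. (ii) If $n\ge2$ and $K_{i,i}=\max_{l}K_{l,l}$, then $i$ is a leaf of $T$. (iii) If $i_1,i_2,\dots,i_l$ is the unique path in $T$ from $i_1$ to $i_l$, then $K_{i_1,i_1}>K_{i_1,i_2}>\dots>K_{i_1,i_l}$. In particular, if $n\ge 2$ and $K_{i,j}=\min_{a,b}K_{a,b}$, then $i$ and $j$ are leaves of $T$.
   Context: $L=D-A$ is the Laplacian ($A$ adjacency matrix, $D$ degree matrix), and $J$ is the all-ones matrix. A leaf is a vertex of degree $1$. -}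

module Defs where

open import Data.Bool using (Bool; true; false; if_then_else_)
open import Data.Nat as ℕ using (ℕ; zero; suc)
open import Data.Integer using (+_; -[1+_])
open import Data.Fin using (Fin; zero; suc; _<?_)
open import Data.Fin.Properties using (_≟_)
open import Data.List using (List; []; _∷_)
open import Data.List.Relation.Unary.Unique.Propositional using (Unique)
open import Data.Rational using (ℚ; _/_; 0ℚ; 1ℚ; _+_; _*_; _-_)
open import Data.Product using (Σ; _×_; ∃; _,_)
open import Relation.Binary.PropositionalEquality using (_≡_)
open import Relation.Nullary using (¬_; does)

ℕ→ℚ : ℕ → ℚ
ℕ→ℚ k = + k / 1

∑ℚ : (n : ℕ) → (Fin n → ℚ) → ℚ
∑ℚ zero    f = 0ℚ
∑ℚ (suc n) f = f zero + ∑ℚ n (λ k → f (suc k))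

∑ℕ : (n : ℕ) → (Fin n → ℕ) → ℕ
∑ℕ zero    f = 0
∑ℕ (suc n) f = f zero ℕ.+ ∑ℕ n (λ k → f (suc k))

-- A simple graph on the vertex set Fin n (vertices 0..n-1 standing for 1..n),
-- given by a Boolean adjacency matrix, symmetric and loopless.
record Graph (n : ℕ) : Set where
  field
    adj   : Fin n → Fin n → Bool
    sym   : ∀ i j → adj i j ≡ adj j i
    loopless : ∀ i → adj i i ≡ false
open Graph public

module _ {n : ℕ} (G : Graph n) where

  deg : Fin n → ℕ
  deg i = ∑ℕ n (λ j → if adj G i j then 1 else 0)

  IsLeaf : Fin n → Set
  IsLeaf i = deg i ≡ 1

  data Walk : Fin n → Fin n → ℕ → Set where
    here : ∀ i → Walk i i 0
    step : ∀ {i j k m} → adj G i j ≡ true → Walk j k m → Walk i k (suc m)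

  verts : ∀ {i j m} → Walk i j m → List (Fin n)
  verts (here i) = i ∷ []
  verts (step {i = i} _ w) = i ∷ verts w

  IsPath : ∀ {i j m} → Walk i j m → Set
  IsPath w = Unique (verts w)

  tailL : List (Fin n) → List (Fin n)
  tailL []       = []
  tailL (_ ∷ xs) = xs

  IsCycle : ∀ {i m} → Walk i i m → Set
  IsCycle {m = m} w = (3 ℕ.≤ m) × Unique (tailL (verts w))

  Connected : Set
  Connected = ∀ i j → ∃ λ m → Walk i j m

  Acyclic : Set
  Acyclic = ∀ i m (w : Walk i i m) → ¬ IsCycle w

  IsTree : Set
  IsTree = Connected × Acyclic

  IsDistance : Fin n → Fin n → ℕ → Set
  IsDistance i j d = Walk i j d × (∀ m → Walk i j m → d ℕ.≤ m)

  laplacian : Fin n → Fin n → ℚ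
  laplacian i j =
    if does (i ≟ j) then ℕ→ℚ (deg i)
    else (if adj G i j then -[1+ 0 ] / 1 else 0ℚ)

  LplusJ : Fin n → Fin n → ℚ
  LplusJ i j = laplacian i j + 1ℚ

  IsInverseOfLplusJ : (Fin n → Fin n → ℚ) → Set
  IsInverseOfLplusJ K =
    (∀ i j → ∑ℚ n (λ k → LplusJ i k * K k j) ≡ (if does (i ≟ j) then 1ℚ else 0ℚ)) ×
    (∀ i j → ∑ℚ n (λ k → K i k * LplusJ k j) ≡ (if does (i ≟ j) then 1ℚ else 0ℚ))

  pairSum : (Fin n → Fin n → ℕ) → ℕ
  pairSum d = ∑ℕ n (λ j → ∑ℕ n (λ m → if does (j <? m) then d j m else 0))

  rowSum : (Fin n → Fin n → ℕ) → Fin n → ℕ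
  rowSum d i = ∑ℕ n (λ j → d i j)

-- The inverse of L + J is explicit:
--   K k j = (r_k + r_j)/(2n) − W/n² + 1/n² − d(k,j)/2,   W = Σ_{j<m} d(j,m).
-- (L + J) K = I rests on one fact about trees: seen from j, every neighbour of i is one step
-- farther away than i, except the unique neighbour towards j when i ≠ j.  Hence
--   Σ_{k~i} d(k,j) = deg i · (d(i,j) + 1) − 2 + 2[i = j],  and summing over j,
--   Σ_{k~i} r_k = deg i · (r_i + n) − 2n + 2.
-- Everything else is read off the formula.  K i i increases with r_i, and at a vertex maximising r
-- the second identity forces deg i = 1.  Across an edge x y leading away from a,
-- K a x − K a y = (n + r_x − r_y)/(2n) > 0 because r_y < r_x + n; along a path from a every edge
-- leads away from a, and a vertex of degree ≥ 2 has a neighbour farther from any given vertex.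

module Submission where

open import Defs renaming (sym to adj-sym)
open import Data.Bool as Bool using (true; false; if_then_else_)
open import Data.Nat as ℕ using (ℕ; zero; suc; z≤n; s≤s; NonZero; _≥_)
import Data.Nat.Properties as ℕP
open import Data.Nat.Coprimality using (1-coprimeTo) renaming (sym to coprime-sym)
open import Data.Integer as ℤ using (+_)
import Data.Integer.Properties as ℤP
open import Data.Fin using (Fin; zero; suc; _<?_)
open import Data.Fin.Properties using (_≟_; any?; <-cmp)
open import Data.Rational as ℚ using (ℚ; mkℚ; _/_; 0ℚ; 1ℚ; ½; _+_; _*_; _-_; _≤_; _<_)
import Data.Rational.Properties as ℚP
open import Data.Rational.Solver using (module +-*-Solver)
open import Algebra.Bundles using (CommutativeMonoid)
open import Algebra.Properties.CommutativeSemigroup ℕP.+-commutativeSemigroup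
  using () renaming (interchange to ℕ-interchange)
open import Algebra.Properties.CommutativeSemigroup
  (CommutativeMonoid.commutativeSemigroup ℚP.+-0-commutativeMonoid)
  using () renaming (interchange to ℚ-interchange)
open import Data.Product using (Σ; ∃; _×_; _,_; proj₁; proj₂)
open import Data.Empty using (⊥; ⊥-elim)
open import Data.Sum as Sum using (_⊎_; inj₁; inj₂)
open import Data.List.Membership.Propositional using (_∈_; _∉_)
open import Data.List.Relation.Binary.Subset.Propositional using (_⊆_)
open import Data.List.Relation.Unary.Any using (here; there)
open import Data.List using (_∷_)
open import Data.List.Relation.Unary.All using (All; []; _∷_)
open import Data.List.Relation.Unary.Unique.Propositional using (Unique)
open import Data.List.Relation.Unary.Linked as Linked using (Linked; [-]; _∷_)
open import Data.List.Relation.Unary.All.Properties using (¬Any⇒All¬)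
open import Data.List.Relation.Unary.AllPairs as AllPairs using ([]; _∷_)
open import Function using (_∘_; id)
open import Relation.Nullary using (¬_; yes; no; does; contradiction; ¬?)
open import Relation.Nullary.Decidable using (_×-dec_; dec-true; dec-false)
open import Relation.Binary.Definitions using (tri<; tri≈; tri>)
open import Relation.Binary.PropositionalEquality

open +-*-Solver using (solve; _:+_; _:*_; _:-_; _:=_; con)

∑ℕ-cong : ∀ n {f g : Fin n → ℕ} → (∀ k → f k ≡ g k) → ∑ℕ n f ≡ ∑ℕ n g
∑ℕ-cong zero    f≗g = refl
∑ℕ-cong (suc n) f≗g = cong₂ ℕ._+_ (f≗g zero) (∑ℕ-cong n (f≗g ∘ suc))

∑ℕ-+ : ∀ n (f g : Fin n → ℕ) → ∑ℕ n (λ k → f k ℕ.+ g k) ≡ ∑ℕ n f ℕ.+ ∑ℕ n g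
∑ℕ-+ zero    f g = refl
∑ℕ-+ (suc n) f g = trans (cong (f zero ℕ.+ g zero ℕ.+_) (∑ℕ-+ n (f ∘ suc) (g ∘ suc)))
                         (ℕ-interchange (f zero) (g zero) _ _)

∑ℕ-*ˡ : ∀ n c (f : Fin n → ℕ) → ∑ℕ n (λ k → c ℕ.* f k) ≡ c ℕ.* ∑ℕ n f
∑ℕ-*ˡ zero    c f = sym (ℕP.*-zeroʳ c)
∑ℕ-*ˡ (suc n) c f = trans (cong (c ℕ.* f zero ℕ.+_) (∑ℕ-*ˡ n c (f ∘ suc)))
                          (sym (ℕP.*-distribˡ-+ c (f zero) _))

∑ℕ-const : ∀ n c → ∑ℕ n (λ _ → c) ≡ n ℕ.* c
∑ℕ-const zero    c = refl
∑ℕ-const (suc n) c = cong (c ℕ.+_) (∑ℕ-const n c)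

∑ℕ-zero : ∀ n → ∑ℕ n (λ _ → 0) ≡ 0
∑ℕ-zero n = trans (∑ℕ-const n 0) (ℕP.*-zeroʳ n)

∑ℕ-suc : ∀ n (f : Fin n → ℕ) → ∑ℕ n (λ k → suc (f k)) ≡ n ℕ.+ ∑ℕ n f
∑ℕ-suc n f = trans (∑ℕ-+ n (λ _ → 1) f) (cong (ℕ._+ ∑ℕ n f) (trans (∑ℕ-const n 1) (ℕP.*-identityʳ n)))

∑ℕ-δ : ∀ n (j : Fin n) c → ∑ℕ n (λ k → if does (j ≟ k) then c else 0) ≡ c
∑ℕ-δ (suc n) zero    c = trans (cong (c ℕ.+_) (∑ℕ-zero n)) (ℕP.+-identityʳ c)
∑ℕ-δ (suc n) (suc j) c = ∑ℕ-δ n j c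

∑ℕ-comm : ∀ n m (F : Fin n → Fin m → ℕ) →
          ∑ℕ n (λ a → ∑ℕ m (F a)) ≡ ∑ℕ m (λ b → ∑ℕ n (λ a → F a b))
∑ℕ-comm zero    m F = sym (∑ℕ-zero m)
∑ℕ-comm (suc n) m F = trans (cong (∑ℕ m (F zero) ℕ.+_) (∑ℕ-comm n m (F ∘ suc)))
                            (sym (∑ℕ-+ m (F zero) _))

∑ℕ-mono-≤ : ∀ n {f g : Fin n → ℕ} → (∀ k → f k ℕ.≤ g k) → ∑ℕ n f ℕ.≤ ∑ℕ n g
∑ℕ-mono-≤ zero    f≤g = z≤n
∑ℕ-mono-≤ (suc n) f≤g = ℕP.+-mono-≤ (f≤g zero) (∑ℕ-mono-≤ n (f≤g ∘ suc))

∑ℕ-mono-< : ∀ n {f g : Fin n → ℕ} → (∀ k → f k ℕ.≤ g k) → ∀ j → f j ℕ.< g j → ∑ℕ n f ℕ.< ∑ℕ n g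
∑ℕ-mono-< (suc n) f≤g zero    fj<gj = ℕP.+-mono-<-≤ fj<gj (∑ℕ-mono-≤ n (f≤g ∘ suc))
∑ℕ-mono-< (suc n) f≤g (suc j) fj<gj = ℕP.+-mono-≤-< (f≤g zero) (∑ℕ-mono-< n (f≤g ∘ suc) j fj<gj)

ℕ→ℚ-mkℚ : ∀ a → ℕ→ℚ a ≡ mkℚ (+ a) 0 (coprime-sym (1-coprimeTo a))
ℕ→ℚ-mkℚ a = ℚP.normalize-coprime (coprime-sym (1-coprimeTo a))

ℕ→ℚ-+ : ∀ a b → ℕ→ℚ (a ℕ.+ b) ≡ ℕ→ℚ a + ℕ→ℚ b
ℕ→ℚ-+ a b rewrite ℕ→ℚ-mkℚ a | ℕ→ℚ-mkℚ b =
  cong (_/ 1) (sym (cong₂ ℤ._+_ (ℤP.*-identityʳ (+ a)) (ℤP.*-identityʳ (+ b))))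

ℕ→ℚ-* : ∀ a b → ℕ→ℚ (a ℕ.* b) ≡ ℕ→ℚ a * ℕ→ℚ b
ℕ→ℚ-* a b rewrite ℕ→ℚ-mkℚ a | ℕ→ℚ-mkℚ b = cong (_/ 1) (ℤP.pos-* a b)

ℕ→ℚ-∑ : ∀ n (f : Fin n → ℕ) → ℕ→ℚ (∑ℕ n f) ≡ ∑ℚ n (ℕ→ℚ ∘ f)
ℕ→ℚ-∑ zero    f = refl
ℕ→ℚ-∑ (suc n) f = trans (ℕ→ℚ-+ (f zero) _) (cong (_+_ (ℕ→ℚ (f zero))) (ℕ→ℚ-∑ n (f ∘ suc)))

∑ℚ-cong : ∀ n {f g : Fin n → ℚ} → (∀ k → f k ≡ g k) → ∑ℚ n f ≡ ∑ℚ n g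
∑ℚ-cong zero    f≗g = refl
∑ℚ-cong (suc n) f≗g = cong₂ _+_ (f≗g zero) (∑ℚ-cong n (f≗g ∘ suc))

∑ℚ-+ : ∀ n (f g : Fin n → ℚ) → ∑ℚ n (λ k → f k + g k) ≡ ∑ℚ n f + ∑ℚ n g
∑ℚ-+ zero    f g = refl
∑ℚ-+ (suc n) f g = trans (cong (_+_ (f zero + g zero)) (∑ℚ-+ n (f ∘ suc) (g ∘ suc)))
                         (ℚ-interchange (f zero) (g zero) _ _)

∑ℚ-- : ∀ n (f g : Fin n → ℚ) → ∑ℚ n (λ k → f k - g k) ≡ ∑ℚ n f - ∑ℚ n g
∑ℚ-- zero    f g = refl
∑ℚ-- (suc n) f g rewrite ∑ℚ-- n (f ∘ suc) (g ∘ suc) =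
  solve 4 (λ a b A B → (a :- b) :+ (A :- B) := (a :+ A) :- (b :+ B)) refl (f zero) (g zero) _ _

∑ℚ-*ˡ : ∀ n c (f : Fin n → ℚ) → ∑ℚ n (λ k → c * f k) ≡ c * ∑ℚ n f
∑ℚ-*ˡ zero    c f = sym (ℚP.*-zeroʳ c)
∑ℚ-*ˡ (suc n) c f = trans (cong (_+_ (c * f zero)) (∑ℚ-*ˡ n c (f ∘ suc)))
                          (sym (ℚP.*-distribˡ-+ c (f zero) _))

∑ℚ-*ʳ : ∀ n c (f : Fin n → ℚ) → ∑ℚ n (λ k → f k * c) ≡ ∑ℚ n f * c
∑ℚ-*ʳ zero    c f = sym (ℚP.*-zeroˡ c)
∑ℚ-*ʳ (suc n) c f = trans (cong (_+_ (f zero * c)) (∑ℚ-*ʳ n c (f ∘ suc)))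
                          (sym (ℚP.*-distribʳ-+ c (f zero) _))

∑ℚ-zero : ∀ n {f : Fin n → ℚ} → (∀ k → f k ≡ 0ℚ) → ∑ℚ n f ≡ 0ℚ
∑ℚ-zero zero    f≗0 = refl
∑ℚ-zero (suc n) f≗0 = trans (cong₂ _+_ (f≗0 zero) (∑ℚ-zero n (f≗0 ∘ suc))) (ℚP.+-identityʳ 0ℚ)

∑ℚ-comm : ∀ n m (F : Fin n → Fin m → ℚ) →
          ∑ℚ n (λ a → ∑ℚ m (F a)) ≡ ∑ℚ m (λ b → ∑ℚ n (λ a → F a b))
∑ℚ-comm zero    m F = sym (∑ℚ-zero m (λ _ → refl))
∑ℚ-comm (suc n) m F = trans (cong (_+_ (∑ℚ m (F zero))) (∑ℚ-comm n m (F ∘ suc)))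
                            (sym (∑ℚ-+ m (F zero) _))

δ : ∀ {n} → Fin n → Fin n → ℚ
δ i j = if does (i ≟ j) then 1ℚ else 0ℚ

∑ℚ-δ* : ∀ n (i : Fin n) (f : Fin n → ℚ) → ∑ℚ n (λ k → δ i k * f k) ≡ f i
∑ℚ-δ* (suc n) zero    f = trans (cong₂ _+_ (ℚP.*-identityˡ (f zero)) (∑ℚ-zero n (ℚP.*-zeroˡ ∘ f ∘ suc)))
                                (ℚP.+-identityʳ (f zero))
∑ℚ-δ* (suc n) (suc i) f = trans (cong₂ _+_ (ℚP.*-zeroˡ (f zero)) refl)
                                (trans (ℚP.+-identityˡ _) (∑ℚ-δ* n i (f ∘ suc)))

∑ℚ-*δ : ∀ n (j : Fin n) (f : Fin n → ℚ) → ∑ℚ n (λ k → f k * δ k j) ≡ f j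
∑ℚ-*δ (suc n) zero    f = trans (cong₂ _+_ (ℚP.*-identityʳ (f zero)) (∑ℚ-zero n (ℚP.*-zeroʳ ∘ f ∘ suc)))
                                (ℚP.+-identityʳ (f zero))
∑ℚ-*δ (suc n) (suc j) f = trans (cong₂ _+_ (ℚP.*-zeroʳ (f zero)) refl)
                                (trans (ℚP.+-identityˡ _) (∑ℚ-*δ n j (f ∘ suc)))

∑ℚ-affine : ∀ n (c x y : Fin n → ℚ) a b e →
            ∑ℚ n (λ k → c k * (a * x k + b - e * y k)) ≡
            a * ∑ℚ n (λ k → c k * x k) + b * ∑ℚ n c - e * ∑ℚ n (λ k → c k * y k)
∑ℚ-affine zero    c x y a b e =
  solve 3 (λ a b e → con 0ℚ := a :* con 0ℚ :+ b :* con 0ℚ :- e :* con 0ℚ) refl a b e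
∑ℚ-affine (suc n) c x y a b e rewrite ∑ℚ-affine n (c ∘ suc) (x ∘ suc) (y ∘ suc) a b e =
  solve 9 (λ c₀ x₀ y₀ a b e X C Y →
             c₀ :* (a :* x₀ :+ b :- e :* y₀) :+ (a :* X :+ b :* C :- e :* Y)
          := a :* (c₀ :* x₀ :+ X) :+ b :* (c₀ :+ C) :- e :* (c₀ :* y₀ :+ Y))
        refl (c zero) (x zero) (y zero) a b e _ _ _

left-inverse≡right-inverse : ∀ {n} (K A M : Fin n → Fin n → ℚ) →
                             (∀ i j → ∑ℚ n (λ k → K i k * A k j) ≡ δ i j) →
                             (∀ i j → ∑ℚ n (λ k → A i k * M k j) ≡ δ i j) →
                             ∀ i j → K i j ≡ M i j
left-inverse≡right-inverse {n} K A M KA≡I AM≡I i j = begin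
  K i j                                               ≡⟨ ∑ℚ-*δ n j (K i) ⟨
  ∑ℚ n (λ k → K i k * δ k j)                          ≡⟨ ∑ℚ-cong n (λ k → cong (K i k *_) (AM≡I k j)) ⟨
  ∑ℚ n (λ k → K i k * ∑ℚ n (λ l → A k l * M l j))     ≡⟨ ∑ℚ-cong n (λ k → ∑ℚ-*ˡ n (K i k) _) ⟨
  ∑ℚ n (λ k → ∑ℚ n (λ l → K i k * (A k l * M l j)))   ≡⟨ ∑ℚ-comm n n _ ⟩
  ∑ℚ n (λ l → ∑ℚ n (λ k → K i k * (A k l * M l j)))   ≡⟨ ∑ℚ-cong n (λ l → ∑ℚ-cong n (λ k → ℚP.*-assoc (K i k) (A k l) (M l j))) ⟨
  ∑ℚ n (λ l → ∑ℚ n (λ k → K i k * A k l * M l j))     ≡⟨ ∑ℚ-cong n (λ l → ∑ℚ-*ʳ n (M l j) _) ⟩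
  ∑ℚ n (λ l → ∑ℚ n (λ k → K i k * A k l) * M l j)     ≡⟨ ∑ℚ-cong n (λ l → cong (_* M l j) (KA≡I i l)) ⟩
  ∑ℚ n (λ l → δ i l * M l j)                          ≡⟨ ∑ℚ-δ* n i (λ l → M l j) ⟩
  M i j                                               ∎
  where open ≡-Reasoning

module GraphProperties {n : ℕ} (G : Graph n) where

  open import Data.List.Membership.DecPropositional (_≟_ {n}) using (_∈?_)

  adj-symmetric : ∀ {i j} → adj G i j ≡ true → adj G j i ≡ true
  adj-symmetric {i} {j} e = trans (adj-sym G j i) e

  adj⇒≢ : ∀ {i j} → adj G i j ≡ true → i ≢ j
  adj⇒≢ {i} e refl with trans (sym e) (loopless G i)
  ... | ()

  snoc : ∀ {i j k m} → Walk G i j m → adj G j k ≡ true → Walk G i k (suc m)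
  snoc (here _)   e = step e (here _)
  snoc (step f w) e = step f (snoc w e)

  reverse : ∀ {i j m} → Walk G i j m → Walk G j i m
  reverse (here i)   = here i
  reverse (step e w) = snoc (reverse w) (adj-symmetric e)

  _++ʷ_ : ∀ {i j k m l} → Walk G i j m → Walk G j k l → Walk G i k (m ℕ.+ l)
  here _   ++ʷ w₂ = w₂
  step e w ++ʷ w₂ = step e (w ++ʷ w₂)

  ∈-++ʷ⁻ : ∀ {i j k m l} (w₁ : Walk G i j m) (w₂ : Walk G j k l) {x} →
           x ∈ verts G (w₁ ++ʷ w₂) → x ∈ verts G w₁ ⊎ x ∈ verts G w₂
  ∈-++ʷ⁻ (here _)    w₂ x∈        = inj₂ x∈
  ∈-++ʷ⁻ (step e w₁) w₂ (here x≡i) = inj₁ (here x≡i)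
  ∈-++ʷ⁻ (step e w₁) w₂ (there x∈) = Sum.map₁ there (∈-++ʷ⁻ w₁ w₂ x∈)

  suffix : ∀ {a b m} (w : Walk G a b m) {x} → x ∈ verts G w →
           ∃ λ m′ → Σ (Walk G x b m′) λ w′ → (IsPath G w → IsPath G w′) × verts G w′ ⊆ verts G w
  suffix (here _)   (here refl) = _ , here _ , id , id
  suffix (step e w) (here refl) = _ , step e w , id , id
  suffix (step e w) (there x∈) with suffix w x∈
  ... | _ , w′ , path⇒path , w′⊆w = _ , w′ , path⇒path ∘ AllPairs.tail , there ∘ w′⊆w

  walk⇒path : ∀ {a b m} (w : Walk G a b m) →
              ∃ λ m′ → Σ (Walk G a b m′) λ p → IsPath G p × verts G p ⊆ verts G w
  walk⇒path (here a) = 0 , here a , [] ∷ [] , id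
  walk⇒path (step {i = a} e w) with walk⇒path w
  ... | _ , p , p-path , p⊆w with a ∈? verts G p
  ...   | yes a∈p with suffix p a∈p
  ...     | _ , p′ , path⇒path , p′⊆p = _ , p′ , path⇒path p-path , there ∘ p⊆w ∘ p′⊆p
  walk⇒path (step {i = a} e w) | _ , p , p-path , p⊆w | no a∉p =
    _ , step e p , ¬Any⇒All¬ (verts G p) a∉p ∷ p-path , λ { (here x≡a) → here x≡a ; (there x∈p) → there (p⊆w x∈p) }

  acyclic⇒no-bypass : Acyclic G → ∀ {i p q m} → adj G i p ≡ true → adj G q i ≡ true → p ≢ q →
                      (P : Walk G p q m) → IsPath G P → i ∉ verts G P → ⊥
  acyclic⇒no-bypass acyclic e₁ e₂ p≢q (here _)     _      _   = p≢q refl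
  acyclic⇒no-bypass acyclic e₁ e₂ p≢q P@(step _ _) P-path i∉P =
    acyclic _ _ (step e₂ (step e₁ P)) (s≤s (s≤s (s≤s z≤n)) , ¬Any⇒All¬ _ i∉P ∷ P-path)

  neighbourSum : Fin n → (Fin n → ℕ) → ℕ
  neighbourSum i f = ∑ℕ n (λ k → if adj G i k then f k else 0)

  adj⇒deg≥1 : ∀ {i k} → adj G i k ≡ true → 1 ℕ.≤ deg G i
  adj⇒deg≥1 {i} {k} e = subst (ℕ._< deg G i) (∑ℕ-zero n)
    (∑ℕ-mono-< n (λ _ → z≤n) k (subst (λ b → 0 ℕ.< (if b then 1 else 0)) (sym e) (s≤s z≤n)))

  deg≥2⇒other-neighbour : ∀ {i} → 2 ℕ.≤ deg G i → ∀ p → ∃ λ v → adj G i v ≡ true × p ≢ v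
  deg≥2⇒other-neighbour {i} deg≥2 p with any? (λ v → (adj G i v Bool.≟ true) ×-dec ¬? (p ≟ v))
  ... | yes found = found
  ... | no  none  = contradiction (ℕP.≤-trans deg≥2 deg≤1) (λ { (s≤s ()) })
    where
    deg≤1 : deg G i ℕ.≤ 1
    deg≤1 = subst (deg G i ℕ.≤_) (∑ℕ-δ n p 1) (∑ℕ-mono-≤ n only-p)
      where
      only-p : ∀ k → (if adj G i k then 1 else 0) ℕ.≤ (if does (p ≟ k) then 1 else 0)
      only-p k with adj G i k in e | p ≟ k
      ... | false | _     = z≤n
      ... | true  | yes _ = ℕP.≤-refl
      ... | true  | no p≢k = contradiction (k , e , p≢k) none

  neighbourSum-cong : ∀ i {f g : Fin n → ℕ} → (∀ k → adj G i k ≡ true → f k ≡ g k) →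
                      neighbourSum i f ≡ neighbourSum i g
  neighbourSum-cong i {f} {g} f≗g = ∑ℕ-cong n pointwise
    where
    pointwise : ∀ k → (if adj G i k then f k else 0) ≡ (if adj G i k then g k else 0)
    pointwise k with adj G i k in e
    ... | true  = f≗g k e
    ... | false = refl

  neighbourSum-+ : ∀ i (f g : Fin n → ℕ) →
                   neighbourSum i (λ k → f k ℕ.+ g k) ≡ neighbourSum i f ℕ.+ neighbourSum i g
  neighbourSum-+ i f g = trans (∑ℕ-cong n pointwise) (∑ℕ-+ n _ _)
    where
    pointwise : ∀ k → (if adj G i k then f k ℕ.+ g k else 0) ≡
                      (if adj G i k then f k else 0) ℕ.+ (if adj G i k then g k else 0)
    pointwise k with adj G i k
    ... | true  = refl
    ... | false = refl

  neighbourSum-const : ∀ i c → neighbourSum i (λ _ → c) ≡ deg G i ℕ.* c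
  neighbourSum-const i c = trans (∑ℕ-cong n pointwise) (trans (∑ℕ-*ˡ n c _) (ℕP.*-comm c (deg G i)))
    where
    pointwise : ∀ k → (if adj G i k then c else 0) ≡ c ℕ.* (if adj G i k then 1 else 0)
    pointwise k with adj G i k
    ... | true  = sym (ℕP.*-identityʳ c)
    ... | false = sym (ℕP.*-zeroʳ c)

  neighbourSum-δ : ∀ {i p} → adj G i p ≡ true → ∀ c →
                   neighbourSum i (λ k → if does (p ≟ k) then c else 0) ≡ c
  neighbourSum-δ {i} {p} e c = trans (∑ℕ-cong n pointwise) (∑ℕ-δ n p c)
    where
    pointwise : ∀ k → (if adj G i k then (if does (p ≟ k) then c else 0) else 0) ≡
                      (if does (p ≟ k) then c else 0)
    pointwise k with p ≟ k
    ... | yes refl rewrite e = refl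
    ... | no  _    with adj G i k
    ...   | true  = refl
    ...   | false = refl

  neighbourSum-∑ : ∀ i m (F : Fin n → Fin m → ℕ) →
                   neighbourSum i (λ k → ∑ℕ m (F k)) ≡ ∑ℕ m (λ j → neighbourSum i (λ k → F k j))
  neighbourSum-∑ i m F = trans (∑ℕ-cong n pointwise) (∑ℕ-comm n m _)
    where
    pointwise : ∀ k → (if adj G i k then ∑ℕ m (F k) else 0) ≡ ∑ℕ m (λ j → if adj G i k then F k j else 0)
    pointwise k with adj G i k
    ... | true  = refl
    ... | false = sym (∑ℕ-zero m)

∃-other : ∀ {n} → 2 ℕ.≤ n → (i : Fin n) → ∃ λ j → i ≢ j
∃-other (s≤s (s≤s _)) zero    = suc zero , λ ()
∃-other (s≤s (s≤s _)) (suc i) = zero , λ ()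

module Distance {n : ℕ} (G : Graph n) (d : Fin n → Fin n → ℕ)
                (d-dist : ∀ i j → IsDistance G i j (d i j)) where

  open GraphProperties G public

  geodesic : ∀ i j → Walk G i j (d i j)
  geodesic i j = proj₁ (d-dist i j)

  d-minimal : ∀ {i j m} → Walk G i j m → d i j ℕ.≤ m
  d-minimal {i} {j} = proj₂ (d-dist i j) _

  d-sym : ∀ i j → d i j ≡ d j i
  d-sym i j = ℕP.≤-antisym (d-minimal (reverse (geodesic j i))) (d-minimal (reverse (geodesic i j)))

  d-refl : ∀ i → d i i ≡ 0
  d-refl i = ℕP.n≤0⇒n≡0 (d-minimal (here i))

  d≡0⇒≡ : ∀ {i j} → d i j ≡ 0 → i ≡ j
  d≡0⇒≡ {i} {j} d≡0 with subst (Walk G i j) d≡0 (geodesic i j)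
  ... | here _ = refl

  d-adj : ∀ {i k} j → adj G i k ≡ true → d i j ℕ.≤ suc (d k j)
  d-adj j e = d-minimal (step e (geodesic _ j))

  adj⇒d≡1 : ∀ {i k} → adj G i k ≡ true → d i k ≡ 1
  adj⇒d≡1 {i} {k} e = ℕP.≤-antisym (subst (λ x → d i k ℕ.≤ suc x) (d-refl k) (d-adj k e))
                                   (ℕP.n≢0⇒n>0 (adj⇒≢ e ∘ d≡0⇒≡))

  d-via : ∀ {a b m} (w : Walk G a b m) {v} → v ∈ verts G w → d a v ℕ.+ d v b ℕ.≤ m
  d-via (here a)              (here refl) rewrite d-refl a = z≤n
  d-via (step {i = a} e w)    (here refl) rewrite d-refl a = d-minimal (step e w)
  d-via (step e w) {v}        (there v∈w) = ℕP.≤-trans (ℕP.+-monoˡ-≤ _ (d-adj v e)) (s≤s (d-via w v∈w))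

  parent : ∀ {i j} → i ≢ j → ∃ λ p → adj G i p ≡ true × d i j ≡ suc (d p j)
  parent {i} {j} i≢j = first-step (geodesic i j) ℕP.≤-refl
    where
    first-step : ∀ {m} → Walk G i j m → m ℕ.≤ d i j → ∃ λ p → adj G i p ≡ true × d i j ≡ suc (d p j)
    first-step (here _)           _      = contradiction refl i≢j
    first-step (step {j = p} e w) m≤dij = p , e , ℕP.≤-antisym (d-adj j e) (ℕP.≤-trans (s≤s (d-minimal w)) m≤dij)

  deg≥1 : 2 ℕ.≤ n → ∀ i → 1 ℕ.≤ deg G i
  deg≥1 n≥2 i = let (_ , i≢j) = ∃-other n≥2 i ; (_ , e , _) = parent i≢j in adj⇒deg≥1 e

  rowSum-adj : ∀ {u v} → adj G u v ≡ true → rowSum G d v ℕ.< n ℕ.+ rowSum G d u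
  rowSum-adj {u} {v} e = subst (rowSum G d v ℕ.<_) (∑ℕ-suc n (d u))
    (∑ℕ-mono-< n (λ x → d-adj x (adj-symmetric e)) v (subst (ℕ._< suc (d u v)) (sym (d-refl v)) (s≤s z≤n)))

  ∑rowSum≡2*pairSum : ∑ℕ n (rowSum G d) ≡ pairSum G d ℕ.+ pairSum G d
  ∑rowSum≡2*pairSum = begin
    ∑ℕ n (λ j → ∑ℕ n (d j))
      ≡⟨ ∑ℕ-cong n (λ j → trans (∑ℕ-cong n (split j)) (∑ℕ-+ n _ _)) ⟩
    ∑ℕ n (λ j → ∑ℕ n (λ m → below j m) ℕ.+ ∑ℕ n (λ m → below m j))
      ≡⟨ ∑ℕ-+ n _ _ ⟩
    pairSum G d ℕ.+ ∑ℕ n (λ j → ∑ℕ n (λ m → below m j))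
      ≡⟨ cong (pairSum G d ℕ.+_) (∑ℕ-comm n n _) ⟩
    pairSum G d ℕ.+ pairSum G d
      ∎
    where
    open ≡-Reasoning
    below : Fin n → Fin n → ℕ
    below j m = if does (j <? m) then d j m else 0
    split : ∀ j m → d j m ≡ below j m ℕ.+ below m j
    split j m with <-cmp j m
    ... | tri< j<m _ m≮j rewrite dec-true (j <? m) j<m | dec-false (m <? j) m≮j = sym (ℕP.+-identityʳ _)
    ... | tri≈ j≮j refl _ rewrite dec-false (j <? j) j≮j = d-refl j
    ... | tri> j≮m _ m<j rewrite dec-false (j <? m) j≮m | dec-true (m <? j) m<j = d-sym j m

-- S stands for Σ_{k~i} r_k, which is at most D r_i when r is maximal at i.
deg-bound : ∀ D R n S → S ℕ.≤ D ℕ.* R → S ℕ.+ n ℕ.* 2 ≡ D ℕ.* (n ℕ.+ R) ℕ.+ 2 → D ℕ.≤ 1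
deg-bound D R n S S≤DR S+2n≡ with D ℕP.≤? 1
... | yes D≤1 = D≤1
... | no  D≰1 = contradiction S+2n≡ (ℕP.<⇒≢ (begin-strict
  S ℕ.+ n ℕ.* 2               ≤⟨ ℕP.+-mono-≤ S≤DR (ℕP.≤-reflexive (ℕP.*-comm n 2)) ⟩
  D ℕ.* R ℕ.+ 2 ℕ.* n         ≤⟨ ℕP.+-monoʳ-≤ (D ℕ.* R) (ℕP.*-monoˡ-≤ n (ℕP.≰⇒> D≰1)) ⟩
  D ℕ.* R ℕ.+ D ℕ.* n         <⟨ ℕP.m<m+n _ (s≤s z≤n) ⟩
  D ℕ.* R ℕ.+ D ℕ.* n ℕ.+ 2   ≡⟨ cong (ℕ._+ 2) (trans (ℕP.+-comm (D ℕ.* R) _) (sym (ℕP.*-distribˡ-+ D n R))) ⟩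
  D ℕ.* (n ℕ.+ R) ℕ.+ 2       ∎))
  where open ℕP.≤-Reasoning

module TreeDistance {n : ℕ} (G : Graph n) (acyclic : Acyclic G) (d : Fin n → Fin n → ℕ)
                    (d-dist : ∀ i j → IsDistance G i j (d i j)) where

  open Distance G d d-dist public

  nearer-neighbour-unique : ∀ {i p q j} → adj G i p ≡ true → adj G i q ≡ true →
                            d p j ℕ.≤ d i j → d q j ℕ.≤ d i j → p ≡ q
  nearer-neighbour-unique {i} {p} {q} {j} ep eq p-near q-near with p ≟ q
  ... | yes p≡q = p≡q
  ... | no  p≢q with walk⇒path (geodesic p j ++ʷ geodesic j q)
  ...   | _ , P , P-path , P⊆ = ⊥-elim (acyclic⇒no-bypass acyclic ep (adj-symmetric eq) p≢q P P-path (i∉ ∘ P⊆))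
    where
    open ℕP.≤-Reasoning
    i∉ : i ∉ verts G (geodesic p j ++ʷ geodesic j q)
    i∉ i∈ with ∈-++ʷ⁻ (geodesic p j) (geodesic j q) i∈
    ... | inj₁ i∈pj = ℕP.<-irrefl refl (begin-strict
      d i j             <⟨ ℕP.n<1+n (d i j) ⟩
      1 ℕ.+ d i j       ≡⟨ cong (ℕ._+ d i j) (adj⇒d≡1 (adj-symmetric ep)) ⟨
      d p i ℕ.+ d i j   ≤⟨ d-via _ i∈pj ⟩
      d p j             ≤⟨ p-near ⟩
      d i j             ∎)
    ... | inj₂ i∈jq = ℕP.<-irrefl refl (begin-strict
      d i j             <⟨ ℕP.m<m+n (d i j) (s≤s z≤n) ⟩
      d i j ℕ.+ 1       ≡⟨ cong₂ ℕ._+_ (d-sym j i) (adj⇒d≡1 eq) ⟨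
      d j i ℕ.+ d i q   ≤⟨ d-via _ i∈jq ⟩
      d j q             ≡⟨ d-sym j q ⟩
      d q j             ≤⟨ q-near ⟩
      d i j             ∎)

  farther-neighbour : ∀ {i p k j} → adj G i p ≡ true → d i j ≡ suc (d p j) →
                      adj G i k ≡ true → p ≢ k → d k j ≡ suc (d i j)
  farther-neighbour {i} {p} {k} {j} ep dij≡ ek p≢k with d k j ℕP.≤? d i j
  ... | yes k-near = contradiction (nearer-neighbour-unique ep ek p-near k-near) p≢k
    where
    p-near : d p j ℕ.≤ d i j
    p-near = subst (d p j ℕ.≤_) (sym dij≡) (ℕP.n≤1+n (d p j))
  ... | no  k-far  = ℕP.≤-antisym (d-adj j (adj-symmetric ek)) (ℕP.≰⇒> k-far)

  outward-neighbour : ∀ {j} → 2 ℕ.≤ deg G j → ∀ i → ∃ λ v → adj G j v ≡ true × d v i ≡ suc (d j i)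
  outward-neighbour {j} deg≥2 i with j ≟ i
  ... | yes refl = let (v , ev , _) = deg≥2⇒other-neighbour deg≥2 j
                   in v , ev , trans (adj⇒d≡1 (adj-symmetric ev)) (cong suc (sym (d-refl j)))
  ... | no  j≢i  = let (p , ep , dji≡) = parent j≢i ; (v , ev , p≢v) = deg≥2⇒other-neighbour deg≥2 p
                   in v , ev , farther-neighbour ep dji≡ ev p≢v

  Outward : Fin n → Fin n → Fin n → Set
  Outward a u v = adj G u v ≡ true × d v a ≡ suc (d u a)

  path-outward-from : ∀ {a p x b m} → Outward a p x → (w : Walk G x b m) →
                      Unique (p ∷ verts G w) → Linked (Outward a) (p ∷ verts G w)
  path-outward-from px (here _) _ = px ∷ [-]
  path-outward-from (e , dxa≡) (step {j = y} e′ w) ((_ ∷ p∉w) ∷ unique) =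
    (e , dxa≡) ∷ path-outward-from (e′ , farther-neighbour (adj-symmetric e) dxa≡ e′ (All-start w p∉w)) w unique
    where
    All-start : ∀ {y b m} {P : Fin n → Set} (w : Walk G y b m) → All P (verts G w) → P y
    All-start (here _)   (Py ∷ _) = Py
    All-start (step _ _) (Py ∷ _) = Py

  path-outward : ∀ {a b m} (w : Walk G a b m) → IsPath G w → Linked (Outward a) (verts G w)
  path-outward (here _)                 _    = [-]
  path-outward (step {i = a} e w) path =
    path-outward-from (e , trans (adj⇒d≡1 (adj-symmetric e)) (cong suc (sym (d-refl a)))) w path

  neighbourSum-d : ∀ i j → neighbourSum i (λ k → d k j) ℕ.+ 2 ≡
                           deg G i ℕ.* suc (d i j) ℕ.+ (if does (i ≟ j) then 2 else 0)
  neighbourSum-d i j with i ≟ j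
  ... | yes refl = cong (ℕ._+ 2) (begin
    neighbourSum i (λ k → d k i)   ≡⟨ neighbourSum-cong i (λ k e → adj⇒d≡1 (adj-symmetric e)) ⟩
    neighbourSum i (λ _ → 1)       ≡⟨ neighbourSum-const i 1 ⟩
    deg G i ℕ.* 1                  ≡⟨ cong (λ x → deg G i ℕ.* suc x) (d-refl i) ⟨
    deg G i ℕ.* suc (d i i)        ∎)
    where open ≡-Reasoning
  ... | no  i≢j with parent i≢j
  ...   | p , ep , dij≡ = begin
    neighbourSum i (λ k → d k j) ℕ.+ 2
      ≡⟨ cong (neighbourSum i (λ k → d k j) ℕ.+_) (neighbourSum-δ ep 2) ⟨
    neighbourSum i (λ k → d k j) ℕ.+ neighbourSum i (λ k → if does (p ≟ k) then 2 else 0)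
      ≡⟨ neighbourSum-+ i _ _ ⟨
    neighbourSum i (λ k → d k j ℕ.+ (if does (p ≟ k) then 2 else 0))
      ≡⟨ neighbourSum-cong i one-step-farther ⟩
    neighbourSum i (λ _ → suc (d i j))
      ≡⟨ neighbourSum-const i _ ⟩
    deg G i ℕ.* suc (d i j)
      ≡⟨ ℕP.+-identityʳ _ ⟨
    deg G i ℕ.* suc (d i j) ℕ.+ 0
      ∎
    where
    open ≡-Reasoning
    one-step-farther : ∀ k → adj G i k ≡ true → d k j ℕ.+ (if does (p ≟ k) then 2 else 0) ≡ suc (d i j)
    one-step-farther k ek with p ≟ k
    ... | yes refl = trans (ℕP.+-comm (d k j) 2) (cong suc (sym dij≡))
    ... | no  p≢k  = trans (ℕP.+-identityʳ _) (farther-neighbour ep dij≡ ek p≢k)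

  neighbourSum-rowSum : ∀ i → neighbourSum i (rowSum G d) ℕ.+ n ℕ.* 2 ≡ deg G i ℕ.* (n ℕ.+ rowSum G d i) ℕ.+ 2
  neighbourSum-rowSum i = begin
    neighbourSum i (rowSum G d) ℕ.+ n ℕ.* 2
      ≡⟨ cong₂ ℕ._+_ (neighbourSum-∑ i n d) (sym (∑ℕ-const n 2)) ⟩
    ∑ℕ n (λ j → neighbourSum i (λ k → d k j)) ℕ.+ ∑ℕ n (λ _ → 2)
      ≡⟨ ∑ℕ-+ n _ _ ⟨
    ∑ℕ n (λ j → neighbourSum i (λ k → d k j) ℕ.+ 2)
      ≡⟨ ∑ℕ-cong n (neighbourSum-d i) ⟩
    ∑ℕ n (λ j → deg G i ℕ.* suc (d i j) ℕ.+ (if does (i ≟ j) then 2 else 0))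
      ≡⟨ ∑ℕ-+ n _ _ ⟩
    ∑ℕ n (λ j → deg G i ℕ.* suc (d i j)) ℕ.+ ∑ℕ n (λ j → if does (i ≟ j) then 2 else 0)
      ≡⟨ cong₂ ℕ._+_ (∑ℕ-*ˡ n (deg G i) _) (∑ℕ-δ n i 2) ⟩
    deg G i ℕ.* ∑ℕ n (λ j → suc (d i j)) ℕ.+ 2
      ≡⟨ cong (λ x → deg G i ℕ.* x ℕ.+ 2) (∑ℕ-suc n (d i)) ⟩
    deg G i ℕ.* (n ℕ.+ rowSum G d i) ℕ.+ 2
      ∎
    where open ≡-Reasoning

  rowSum-max⇒leaf : 2 ℕ.≤ n → ∀ i → (∀ v → rowSum G d v ℕ.≤ rowSum G d i) → IsLeaf G i
  rowSum-max⇒leaf n≥2 i rᵢ-max = ℕP.≤-antisym (deg-bound _ _ n _ neighbourSum≤ (neighbourSum-rowSum i)) (deg≥1 n≥2 i)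
    where
    neighbourSum≤ : neighbourSum i (rowSum G d) ℕ.≤ deg G i ℕ.* rowSum G d i
    neighbourSum≤ = ℕP.≤-trans (∑ℕ-mono-≤ n pointwise) (ℕP.≤-reflexive (neighbourSum-const i (rowSum G d i)))
      where
      pointwise : ∀ k → (if adj G i k then rowSum G d k else 0) ℕ.≤ (if adj G i k then rowSum G d i else 0)
      pointwise k with adj G i k
      ... | true  = rᵢ-max k
      ... | false = z≤n

1/n*n≡1 : ∀ n .{{_ : NonZero n}} → (+ 1 / n) * ℕ→ℚ n ≡ 1ℚ
1/n*n≡1 (suc n) rewrite ℚP.normalize-coprime {1} {n} (1-coprimeTo (suc n)) | ℕ→ℚ-mkℚ (suc n) =
  ℚP.*-inverseˡ (mkℚ (+ suc n) 0 (coprime-sym (1-coprimeTo (suc n))))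

x+y≡z⇒x≡z-y : ∀ {x y z : ℚ} → x + y ≡ z → x ≡ z - y
x+y≡z⇒x≡z-y {x} {y} refl = solve 2 (λ x y → x := (x :+ y) :- y) refl x y

x≡y+c*[1-a]⇒x≡y : ∀ {x y c a : ℚ} → x ≡ y + c * (1ℚ - a) → a ≡ 1ℚ → x ≡ y
x≡y+c*[1-a]⇒x≡y {y = y} {c} x≡ refl =
  trans x≡ (trans (cong (λ z → y + c * z) (ℚP.+-inverseʳ 1ℚ)) (trans (cong (_+_ y) (ℚP.*-zeroʳ c)) (ℚP.+-identityʳ y)))

-- The row sums of (L + J) times the candidate inverse, as a ring identity modulo u ν = 1 (u = 1/n, ν = n).
gram-row-algebra : ∀ (u ν D rᵢ rⱼ dᵢⱼ W δᵢⱼ S N : ℚ) → u * ν ≡ 1ℚ →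
                   S + ν * ℕ→ℚ 2 ≡ D * (ν + rᵢ) + ℕ→ℚ 2 →
                   N + ℕ→ℚ 2 ≡ D * (1ℚ + dᵢⱼ) + (δᵢⱼ + δᵢⱼ) →
                   (u * ½) * (D * rᵢ - S + (W + W)) + u * (½ * rⱼ - u * W + u) * ν
                     - ½ * (D * dᵢⱼ - N + rⱼ) ≡ δᵢⱼ
gram-row-algebra u ν D rᵢ rⱼ dᵢⱼ W δᵢⱼ S N uν≡1 S≡ N≡
  with refl ← x+y≡z⇒x≡z-y {S} {ν * ℕ→ℚ 2} S≡ | refl ← x+y≡z⇒x≡z-y {N} {ℕ→ℚ 2} N≡ =
  x≡y+c*[1-a]⇒x≡y {c = u * W + ½ * D - ½ * rⱼ - u - 1ℚ}
    (solve 8 (λ u ν D rᵢ rⱼ dᵢⱼ W δᵢⱼ →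
                (u :* con ½) :* (D :* rᵢ :- (D :* (ν :+ rᵢ) :+ con two :- ν :* con two) :+ (W :+ W))
                :+ u :* (con ½ :* rⱼ :- u :* W :+ u) :* ν
                :- con ½ :* (D :* dᵢⱼ :- (D :* (con 1ℚ :+ dᵢⱼ) :+ (δᵢⱼ :+ δᵢⱼ) :- con two) :+ rⱼ)
             := δᵢⱼ :+ (u :* W :+ con ½ :* D :- con ½ :* rⱼ :- u :- con 1ℚ) :* (con 1ℚ :- u :* ν))
           refl u ν D rᵢ rⱼ dᵢⱼ W δᵢⱼ)
    uν≡1
  where
  two : ℚ
  two = ℕ→ℚ 2

-- The same for the difference of two entries of a row across an edge pointing away from the row index.
gram-edge-algebra : ∀ (u ν rₐ rₓ r_y W dₐₓ g : ℚ) → u * ν ≡ 1ℚ → ν + rₓ ≡ r_y + g →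
                    u * (½ * (rₐ + rₓ) - u * W + u) - ½ * dₐₓ ≡
                    (u * (½ * (rₐ + r_y) - u * W + u) - ½ * (1ℚ + dₐₓ)) + (u * ½) * g
gram-edge-algebra u ν rₐ rₓ r_y W dₐₓ g uν≡1 g≡
  with refl ← x+y≡z⇒x≡z-y {g} {r_y} (trans (ℚP.+-comm g r_y) (sym g≡)) =
  x≡y+c*[1-a]⇒x≡y {c = ½}
    (solve 7 (λ u ν rₐ rₓ r_y W dₐₓ →
                u :* (con ½ :* (rₐ :+ rₓ) :- u :* W :+ u) :- con ½ :* dₐₓ
             := ((u :* (con ½ :* (rₐ :+ r_y) :- u :* W :+ u) :- con ½ :* (con 1ℚ :+ dₐₓ))
                 :+ (u :* con ½) :* ((ν :+ rₓ) :- r_y))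
                :+ con ½ :* (con 1ℚ :- u :* ν))
           refl u ν rₐ rₓ r_y W dₐₓ)
    uν≡1

instance
  ½-positive : ℚ.Positive ½
  ½-positive = ℚP.normalize-pos 1 2

ℕ→ℚ-suc-positive : ∀ o → ℚ.Positive (ℕ→ℚ (suc o))
ℕ→ℚ-suc-positive o = ℚP.normalize-pos (suc o) 1

x<x+p : ∀ x p .{{_ : ℚ.Positive p}} → x < x + p
x<x+p x p = subst (_< x + p) (ℚP.+-identityʳ x) (ℚP.+-monoʳ-< x (ℚP.positive⁻¹ p))

ℕ→ℚ-<-gap : ∀ {a b} → a ℕ.< b → ∃ λ o → ℕ→ℚ b ≡ ℕ→ℚ a + ℕ→ℚ (suc o)
ℕ→ℚ-<-gap {a} a<b = let (o , a+1+o≡b) = ℕP.m≤n⇒∃[o]m+o≡n a<b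
                    in o , trans (cong ℕ→ℚ (trans (sym a+1+o≡b) (sym (ℕP.+-suc a o)))) (ℕ→ℚ-+ a (suc o))

module GramMatrix {n : ℕ} .{{_ : NonZero n}} (G : Graph n) (acyclic : Acyclic G)
                  (d : Fin n → Fin n → ℕ) (d-dist : ∀ i j → IsDistance G i j (d i j)) where

  open TreeDistance G acyclic d d-dist

  1/n ν W : ℚ
  1/n = + 1 / n
  ν   = ℕ→ℚ n
  W   = ℕ→ℚ (pairSum G d)

  r : Fin n → ℚ
  r = ℕ→ℚ ∘ rowSum G d

  gram : Fin n → Fin n → ℚ
  gram k j = 1/n * (½ * (r k + r j) - 1/n * W + 1/n) - ½ * ℕ→ℚ (d k j)

  gram-affine : ∀ k j → gram k j ≡ (1/n * ½) * r k + 1/n * (½ * r j - 1/n * W + 1/n) - ½ * ℕ→ℚ (d k j)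
  gram-affine k j = solve 6 (λ u rₖ rⱼ W dₖⱼ h →
                               u :* (h :* (rₖ :+ rⱼ) :- u :* W :+ u) :- h :* dₖⱼ
                            := (u :* h) :* rₖ :+ u :* (h :* rⱼ :- u :* W :+ u) :- h :* dₖⱼ)
                            refl 1/n (r k) (r j) W (ℕ→ℚ (d k j)) ½

  LplusJ-row : ∀ i (f : Fin n → ℕ) →
               ∑ℚ n (λ k → LplusJ G i k * ℕ→ℚ (f k)) ≡
               ℕ→ℚ (deg G i) * ℕ→ℚ (f i) - ℕ→ℚ (neighbourSum i f) + ℕ→ℚ (∑ℕ n f)
  LplusJ-row i f = begin
    ∑ℚ n (λ k → LplusJ G i k * ℕ→ℚ (f k))
      ≡⟨ ∑ℚ-cong n entry ⟩
    ∑ℚ n (λ k → δ i k * (ℕ→ℚ (deg G i) * ℕ→ℚ (f k)) - ℕ→ℚ (if adj G i k then f k else 0) + ℕ→ℚ (f k))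
      ≡⟨ trans (∑ℚ-+ n _ _) (cong (_+ _) (∑ℚ-- n _ _)) ⟩
    ∑ℚ n (λ k → δ i k * (ℕ→ℚ (deg G i) * ℕ→ℚ (f k))) - ∑ℚ n (λ k → ℕ→ℚ (if adj G i k then f k else 0))
      + ∑ℚ n (ℕ→ℚ ∘ f)
      ≡⟨ cong₂ _+_ (cong₂ _-_ (∑ℚ-δ* n i _) (sym (ℕ→ℚ-∑ n _))) (sym (ℕ→ℚ-∑ n f)) ⟩
    ℕ→ℚ (deg G i) * ℕ→ℚ (f i) - ℕ→ℚ (neighbourSum i f) + ℕ→ℚ (∑ℕ n f)
      ∎
    where
    open ≡-Reasoning
    entry : ∀ k → LplusJ G i k * ℕ→ℚ (f k) ≡
                  δ i k * (ℕ→ℚ (deg G i) * ℕ→ℚ (f k)) - ℕ→ℚ (if adj G i k then f k else 0) + ℕ→ℚ (f k)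
    entry k with i ≟ k
    ... | yes refl rewrite loopless G i =
      solve 2 (λ D x → (D :+ con 1ℚ) :* x := con 1ℚ :* (D :* x) :- con 0ℚ :+ x) refl (ℕ→ℚ (deg G i)) (ℕ→ℚ (f i))
    ... | no _ with adj G i k
    ...   | true  = solve 2 (λ D x → (con (ℤ.-[1+ 0 ] / 1) :+ con 1ℚ) :* x := con 0ℚ :* (D :* x) :- x :+ x)
                          refl (ℕ→ℚ (deg G i)) (ℕ→ℚ (f k))
    ...   | false = solve 2 (λ D x → (con 0ℚ :+ con 1ℚ) :* x := con 0ℚ :* (D :* x) :- con 0ℚ :+ x)
                          refl (ℕ→ℚ (deg G i)) (ℕ→ℚ (f k))

  LplusJ-row-one : ∀ i → ∑ℚ n (LplusJ G i) ≡ ν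
  LplusJ-row-one i = begin
    ∑ℚ n (LplusJ G i)                          ≡⟨ ∑ℚ-cong n (λ k → ℚP.*-identityʳ (LplusJ G i k)) ⟨
    ∑ℚ n (λ k → LplusJ G i k * ℕ→ℚ 1)          ≡⟨ LplusJ-row i (λ _ → 1) ⟩
    D * 1ℚ - D + ℕ→ℚ (∑ℕ n (λ _ → 1))          ≡⟨ cong (λ x → D * 1ℚ - D + ℕ→ℚ x) (trans (∑ℕ-const n 1) (ℕP.*-identityʳ n)) ⟩
    D * 1ℚ - D + ν                             ≡⟨ solve 2 (λ D ν → D :* con 1ℚ :- D :+ ν := ν) refl D ν ⟩
    ν                                          ∎
    where
    open ≡-Reasoning
    D : ℚ
    D = ℕ→ℚ (deg G i)

  LplusJ-row-r : ∀ i → ∑ℚ n (λ k → LplusJ G i k * r k) ≡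
                       ℕ→ℚ (deg G i) * r i - ℕ→ℚ (neighbourSum i (rowSum G d)) + (W + W)
  LplusJ-row-r i = trans (LplusJ-row i (rowSum G d))
    (cong (λ s → ℕ→ℚ (deg G i) * r i - ℕ→ℚ (neighbourSum i (rowSum G d)) + s)
          (trans (cong ℕ→ℚ ∑rowSum≡2*pairSum) (ℕ→ℚ-+ (pairSum G d) (pairSum G d))))

  LplusJ-row-d : ∀ i j → ∑ℚ n (λ k → LplusJ G i k * ℕ→ℚ (d k j)) ≡
                         ℕ→ℚ (deg G i) * ℕ→ℚ (d i j) - ℕ→ℚ (neighbourSum i (λ k → d k j)) + r j
  LplusJ-row-d i j = trans (LplusJ-row i (λ k → d k j))
    (cong (λ s → ℕ→ℚ (deg G i) * ℕ→ℚ (d i j) - ℕ→ℚ (neighbourSum i (λ k → d k j)) + s)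
          (cong ℕ→ℚ (∑ℕ-cong n (λ k → d-sym k j))))

  neighbourSum-rowSum-ℚ : ∀ i → ℕ→ℚ (neighbourSum i (rowSum G d)) + ν * ℕ→ℚ 2 ≡
                                ℕ→ℚ (deg G i) * (ν + r i) + ℕ→ℚ 2
  neighbourSum-rowSum-ℚ i = begin
    ℕ→ℚ (neighbourSum i (rowSum G d)) + ν * ℕ→ℚ 2   ≡⟨ cong (_+_ (ℕ→ℚ (neighbourSum i (rowSum G d)))) (ℕ→ℚ-* n 2) ⟨
    ℕ→ℚ (neighbourSum i (rowSum G d)) + ℕ→ℚ (n ℕ.* 2) ≡⟨ ℕ→ℚ-+ (neighbourSum i (rowSum G d)) (n ℕ.* 2) ⟨
    ℕ→ℚ (neighbourSum i (rowSum G d) ℕ.+ n ℕ.* 2)    ≡⟨ cong ℕ→ℚ (neighbourSum-rowSum i) ⟩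
    ℕ→ℚ (deg G i ℕ.* (n ℕ.+ rowSum G d i) ℕ.+ 2)    ≡⟨ ℕ→ℚ-+ (deg G i ℕ.* (n ℕ.+ rowSum G d i)) 2 ⟩
    ℕ→ℚ (deg G i ℕ.* (n ℕ.+ rowSum G d i)) + ℕ→ℚ 2  ≡⟨ cong (_+ ℕ→ℚ 2) (trans (ℕ→ℚ-* (deg G i) _) (cong (ℕ→ℚ (deg G i) *_) (ℕ→ℚ-+ n (rowSum G d i)))) ⟩
    ℕ→ℚ (deg G i) * (ν + r i) + ℕ→ℚ 2              ∎
    where open ≡-Reasoning

  neighbourSum-d-ℚ : ∀ i j → ℕ→ℚ (neighbourSum i (λ k → d k j)) + ℕ→ℚ 2 ≡
                             ℕ→ℚ (deg G i) * (1ℚ + ℕ→ℚ (d i j)) + (δ i j + δ i j)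
  neighbourSum-d-ℚ i j = begin
    ℕ→ℚ (neighbourSum i (λ k → d k j)) + ℕ→ℚ 2         ≡⟨ ℕ→ℚ-+ (neighbourSum i (λ k → d k j)) 2 ⟨
    ℕ→ℚ (neighbourSum i (λ k → d k j) ℕ.+ 2)           ≡⟨ cong ℕ→ℚ (neighbourSum-d i j) ⟩
    ℕ→ℚ (deg G i ℕ.* suc (d i j) ℕ.+ δ₂)               ≡⟨ ℕ→ℚ-+ (deg G i ℕ.* suc (d i j)) δ₂ ⟩
    ℕ→ℚ (deg G i ℕ.* suc (d i j)) + ℕ→ℚ δ₂             ≡⟨ cong₂ _+_ (trans (ℕ→ℚ-* (deg G i) (suc (d i j))) (cong (ℕ→ℚ (deg G i) *_) (ℕ→ℚ-+ 1 (d i j)))) δ₂≡ ⟩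
    ℕ→ℚ (deg G i) * (1ℚ + ℕ→ℚ (d i j)) + (δ i j + δ i j) ∎
    where
    open ≡-Reasoning
    δ₂ : ℕ
    δ₂ = if does (i ≟ j) then 2 else 0
    δ₂≡ : ℕ→ℚ δ₂ ≡ δ i j + δ i j
    δ₂≡ with does (i ≟ j)
    ... | true  = refl
    ... | false = refl

  gram-row : ∀ i j → ∑ℚ n (λ k → LplusJ G i k * gram k j) ≡ δ i j
  gram-row i j = begin
    ∑ℚ n (λ k → LplusJ G i k * gram k j)
      ≡⟨ ∑ℚ-cong n (λ k → cong (LplusJ G i k *_) (gram-affine k j)) ⟩
    ∑ℚ n (λ k → LplusJ G i k * ((1/n * ½) * r k + c - ½ * ℕ→ℚ (d k j)))
      ≡⟨ ∑ℚ-affine n (LplusJ G i) r (λ k → ℕ→ℚ (d k j)) (1/n * ½) c ½ ⟩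
    (1/n * ½) * ∑ℚ n (λ k → LplusJ G i k * r k) + c * ∑ℚ n (LplusJ G i)
      - ½ * ∑ℚ n (λ k → LplusJ G i k * ℕ→ℚ (d k j))
      ≡⟨ cong₂ _-_ (cong₂ _+_ (cong (1/n * ½ *_) (LplusJ-row-r i)) (cong (c *_) (LplusJ-row-one i)))
                   (cong (½ *_) (LplusJ-row-d i j)) ⟩
    (1/n * ½) * (D * r i - ℕ→ℚ (neighbourSum i (rowSum G d)) + (W + W)) + c * ν
      - ½ * (D * ℕ→ℚ (d i j) - ℕ→ℚ (neighbourSum i (λ k → d k j)) + r j)
      ≡⟨ gram-row-algebra 1/n ν D (r i) (r j) (ℕ→ℚ (d i j)) W (δ i j) _ _
                          (1/n*n≡1 n) (neighbourSum-rowSum-ℚ i) (neighbourSum-d-ℚ i j) ⟩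
    δ i j
      ∎
    where
    open ≡-Reasoning
    c D : ℚ
    c = 1/n * (½ * r j - 1/n * W + 1/n)
    D = ℕ→ℚ (deg G i)

  inverse≡gram : ∀ {K} → IsInverseOfLplusJ G K → ∀ i j → K i j ≡ gram i j
  inverse≡gram {K} (_ , K[L+J]≡I) = left-inverse≡right-inverse K (LplusJ G) gram K[L+J]≡I gram-row

  gram-diag : ∀ i → gram i i ≡ 1/n * (r i - 1/n * W + 1/n)
  gram-diag i rewrite d-refl i =
    solve 3 (λ u rᵢ W → u :* (con ½ :* (rᵢ :+ rᵢ) :- u :* W :+ u) :- con ½ :* con 0ℚ := u :* (rᵢ :- u :* W :+ u))
          refl 1/n (r i) W

  gram-sym : ∀ i j → gram i j ≡ gram j i
  gram-sym i j = cong₂ (λ s t → 1/n * (½ * s - 1/n * W + 1/n) - ½ * ℕ→ℚ t) (ℚP.+-comm (r i) (r j)) (d-sym i j)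

  instance
    1/n-positive : ℚ.Positive 1/n
    1/n-positive = ℚP.normalize-pos 1 n

  gram-diag-< : ∀ {l v} → rowSum G d l ℕ.< rowSum G d v → gram l l < gram v v
  gram-diag-< {l} {v} rₗ<rᵥ with ℕ→ℚ-<-gap rₗ<rᵥ
  ... | o , rᵥ≡ = subst (gram l l <_) (sym gram-vv≡) (x<x+p (gram l l) (1/n * ℕ→ℚ (suc o)) {{pos}})
    where
    pos : ℚ.Positive (1/n * ℕ→ℚ (suc o))
    pos = ℚP.pos*pos⇒pos 1/n (ℕ→ℚ (suc o)) {{ℕ→ℚ-suc-positive o}}
    gram-vv≡ : gram v v ≡ gram l l + 1/n * ℕ→ℚ (suc o)
    gram-vv≡ = begin
      gram v v                                         ≡⟨ gram-diag v ⟩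
      1/n * (r v - 1/n * W + 1/n)                      ≡⟨ cong (λ x → 1/n * (x - 1/n * W + 1/n)) rᵥ≡ ⟩
      1/n * (r l + ℕ→ℚ (suc o) - 1/n * W + 1/n)        ≡⟨ solve 4 (λ u rₗ g W → u :* (rₗ :+ g :- u :* W :+ u)
                                                             := u :* (rₗ :- u :* W :+ u) :+ u :* g)
                                                             refl 1/n (r l) (ℕ→ℚ (suc o)) W ⟩
      1/n * (r l - 1/n * W + 1/n) + 1/n * ℕ→ℚ (suc o)  ≡⟨ cong (_+ 1/n * ℕ→ℚ (suc o)) (gram-diag l) ⟨
      gram l l + 1/n * ℕ→ℚ (suc o)                     ∎
      where open ≡-Reasoning

  gram-outward-< : ∀ {a x y} → Outward a x y → gram a y < gram a x
  gram-outward-< {a} {x} {y} (e , dya≡) with ℕ→ℚ-<-gap (rowSum-adj e)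
  ... | o , gap = subst (gram a y <_) (sym gram-ax≡) (x<x+p (gram a y) (1/n * ½ * ℕ→ℚ (suc o)) {{pos}})
    where
    pos : ℚ.Positive (1/n * ½ * ℕ→ℚ (suc o))
    pos = ℚP.pos*pos⇒pos (1/n * ½) {{ℚP.pos*pos⇒pos 1/n ½}} (ℕ→ℚ (suc o)) {{ℕ→ℚ-suc-positive o}}
    day≡ : ℕ→ℚ (d a y) ≡ 1ℚ + ℕ→ℚ (d a x)
    day≡ = trans (cong ℕ→ℚ (trans (d-sym a y) (trans dya≡ (cong suc (d-sym x a))))) (ℕ→ℚ-+ 1 (d a x))
    gram-ax≡ : gram a x ≡ gram a y + 1/n * ½ * ℕ→ℚ (suc o)
    gram-ax≡ = trans (gram-edge-algebra 1/n ν (r a) (r x) (r y) W (ℕ→ℚ (d a x)) (ℕ→ℚ (suc o))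
                                       (1/n*n≡1 n) (trans (sym (ℕ→ℚ-+ n (rowSum G d x))) gap))
                     (cong (λ t → 1/n * (½ * (r a + r y) - 1/n * W + 1/n) - ½ * t + 1/n * ½ * ℕ→ℚ (suc o)) (sym day≡))

  gram-diag-max⇒leaf : 2 ℕ.≤ n → ∀ i → (∀ l → gram l l ≤ gram i i) → IsLeaf G i
  gram-diag-max⇒leaf n≥2 i gramᵢᵢ-max = rowSum-max⇒leaf n≥2 i λ v →
    ℕP.≮⇒≥ (λ rᵢ<rᵥ → ℚP.<-irrefl refl (ℚP.<-≤-trans (gram-diag-< rᵢ<rᵥ) (gramᵢᵢ-max v)))

  gram-path-decreasing : ∀ {a b m} (w : Walk G a b m) → IsPath G w →
                         Linked (λ u v → gram a v < gram a u) (verts G w)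
  gram-path-decreasing w path = Linked.map gram-outward-< (path-outward w path)

  gram-min⇒leaf : 2 ℕ.≤ n → ∀ i j → (∀ a b → gram i j ≤ gram a b) → IsLeaf G j
  gram-min⇒leaf n≥2 i j gramᵢⱼ-min = ℕP.≤-antisym (ℕP.≮⇒≥ deg≯1) (deg≥1 n≥2 j)
    where
    deg≯1 : ¬ (1 ℕ.< deg G j)
    deg≯1 deg≥2 = let (v , ev , dvi≡) = outward-neighbour deg≥2 i
                  in ℚP.<-irrefl refl (ℚP.<-≤-trans (gram-outward-< (ev , dvi≡)) (gramᵢⱼ-min i v))

lemma6p5 : {n : ℕ} .{{_ : NonZero n}} (T : Graph n) → IsTree T →
           (K : Fin n → Fin n → ℚ) → IsInverseOfLplusJ T K →
           (d : Fin n → Fin n → ℕ) → (∀ i j → IsDistance T i j (d i j)) →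
           ((∀ i → K i i ≡ (+ 1 / n) * (ℕ→ℚ (rowSum T d i) - (+ 1 / n) * ℕ→ℚ (pairSum T d) + (+ 1 / n)))
           × (n ≥ 2 → ∀ i → (∀ l → K l l ≤ K i i) → IsLeaf T i)
           × (∀ a b m (w : Walk T a b m) → IsPath T w → Linked (λ u v → K a v < K a u) (verts T w))
           × (n ≥ 2 → ∀ i j → (∀ a b → K i j ≤ K a b) → IsLeaf T i × IsLeaf T j))
lemma6p5 T (_ , acyclic) K K-inverse d d-dist =
    (λ i → trans (K≡gram i i) (gram-diag i))
  , (λ n≥2 i Kᵢᵢ-max → gram-diag-max⇒leaf n≥2 i λ l → subst₂ _≤_ (K≡gram l l) (K≡gram i i) (Kᵢᵢ-max l))
  , (λ a b m w path → Linked.map (λ {u} {v} → subst₂ _<_ (sym (K≡gram a v)) (sym (K≡gram a u)))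
                                 (gram-path-decreasing w path))
  , (λ n≥2 i j Kᵢⱼ-min →
       let gramᵢⱼ-min = λ a b → subst₂ _≤_ (K≡gram i j) (K≡gram a b) (Kᵢⱼ-min a b)
       in gram-min⇒leaf n≥2 j i (λ a b → subst (_≤ gram a b) (gram-sym i j) (gramᵢⱼ-min a b))
        , gram-min⇒leaf n≥2 i j gramᵢⱼ-min)
  where
  open GramMatrix T acyclic d d-dist
  K≡gram : ∀ i j → K i j ≡ gram i j
  K≡gram = inverse≡gram K-inverse
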